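{- Let $D$ be a series-parallel digraph, let $\mathbf P^*$ be a fixed optimal path profile (with $k$ paths) for Min-Max Disjoint Paths on $D$, and let $\mathbf P$ be a path profile of $k$ paths in $D$ that is consistent and balanced in $D$. Then $C_{\max}(\mathbf P,D)\le H_k\cdot C_{\max}(\mathbf P^*,D)$.
   Context: Min-Max Disjoint Paths: given a digraph $D=(V,A)$ with source $s$, sink $t$, travel times $\tau:A\to\mathbb{Z}_{\ge0}$ and integer $k$, find $k$ pairwise arc-disjoint $s$-$t$-paths (a path profile) minimizing the maximum path length. For a path profile $\mathbf P$: $C_{\max}(\mathbf P,D)=\max_{P\in\mathbf P}\sum_{a\in P}\tau_a$ and $\theta(\mathbf P,D)=\sum_{P\in\mathbf P}\sum_{a\in P}\tau_a$. $\mathbf P$ is consistent in $D$ if it has the same number of paths as $\mathbf P^*$ and $\theta(\mathbf P,D)\le\theta(\mathbf P^*,D)$. If $\mathbf P$ has path lengths $p_1\ge\dots\ge p_k$, it is balanced in $D$ if $\frac1i\sum_{j=1}^ip_j-p_{i+1}\le C_{\max}(\mathbf P^*,D)$ for all $i\in[k-1]$. $H_k=\sum_{j=1}^k\frac1j$. -}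

module Defs where

open import Data.Nat as ℕ using (ℕ; zero; suc; _+_; _⊔_)
open import Data.Integer using (+_)
open import Data.Rational as ℚ using (ℚ; 0ℚ)
open import Data.Fin as Fin using (Fin; zero; suc; fromℕ<)
open import Data.Fin.Permutation using (Permutation′; _⟨$⟩ʳ_)
open import Data.Vec using (Vec; lookup; foldr)
open import Data.Empty using (⊥)
open import Relation.Binary.PropositionalEquality using (_≡_)
open import Relation.Nullary using (¬_)

-- Two-terminal series-parallel digraphs with travel times on the arcs.
-- `arc τ` : a single arc s → t with travel time τ,
-- `ser G H` : series composition (t of G identified with s of H),
-- `par G H` : parallel composition (sources and sinks identified).

data SP : Set where
  arc : ℕ → SP
  ser : SP → SP → SP
  par : SP → SP → SP

data Arc : SP → Set where
  here : ∀ {τ} → Arc (arc τ)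
  serˡ : ∀ {G H} → Arc G → Arc (ser G H)
  serʳ : ∀ {G H} → Arc H → Arc (ser G H)
  parˡ : ∀ {G H} → Arc G → Arc (par G H)
  parʳ : ∀ {G H} → Arc H → Arc (par G H)

τ : ∀ {G} → Arc G → ℕ
τ (here {t}) = t
τ (serˡ a) = τ a
τ (serʳ a) = τ a
τ (parˡ a) = τ a
τ (parʳ a) = τ a

data Path : SP → Set where
  edge  : ∀ {t} → Path (arc t)
  _▷_   : ∀ {G H} → Path G → Path H → Path (ser G H)
  left  : ∀ {G H} → Path G → Path (par G H)
  right : ∀ {G H} → Path H → Path (par G H)

data _∈P_ : ∀ {G} → Arc G → Path G → Set where
  here∈ : ∀ {t} → here {t} ∈P edge
  serˡ∈ : ∀ {G H} {a : Arc G} {p : Path G} {q : Path H} → a ∈P p → serˡ a ∈P (p ▷ q)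
  serʳ∈ : ∀ {G H} {a : Arc H} {p : Path G} {q : Path H} → a ∈P q → serʳ a ∈P (p ▷ q)
  parˡ∈ : ∀ {G H} {a : Arc G} {p : Path G} → a ∈P p → parˡ a ∈P left {H = H} p
  parʳ∈ : ∀ {G H} {a : Arc H} {p : Path H} → a ∈P p → parʳ a ∈P right {G = G} p

len : ∀ {G} → Path G → ℕ
len (edge {t}) = t
len (p ▷ q) = len p + len q
len (left p) = len p
len (right p) = len p

IsProfile : ∀ {G k} → Vec (Path G) k → Set
IsProfile {G} {k} P =
  (i j : Fin k) → ¬ (i ≡ j) → (a : Arc G) → a ∈P lookup P i → ¬ (a ∈P lookup P j)

Cmax : ∀ {G k} → Vec (Path G) k → ℕ
Cmax P = foldr _ (λ p m → len p ⊔ m) 0 P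

θ : ∀ {G k} → Vec (Path G) k → ℕ
θ P = foldr _ (λ p m → len p + m) 0 P

IsOptimal : ∀ {G k} → Vec (Path G) k → Set
IsOptimal {G} {k} P* =
  IsProfile P* × ((Q : Vec (Path G) k) → IsProfile Q → Cmax P* ℕ.≤ Cmax Q)
  where open import Data.Product using (_×_)

-- Consistency (same number of paths is enforced by the type).
Consistent : ∀ {G k} → Vec (Path G) k → Vec (Path G) k → Set
Consistent P P* = θ P ℕ.≤ θ P*

-- Sum of the first m values f 0, …, f (m-1) (truncated at k).
sumTo : ∀ {k} → (Fin k → ℕ) → ℕ → ℕ
sumTo {zero}  f m       = 0
sumTo {suc k} f zero    = 0
sumTo {suc k} f (suc m) = f zero + sumTo (λ j → f (suc j)) m

Nonincreasing : ∀ {k} → (Fin k → ℕ) → Set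
Nonincreasing {k} p = (j l : Fin k) → j Fin.≤ l → p l ℕ.≤ p j

-- Balancedness of P with respect to P*: for the path lengths
-- p₁ ≥ … ≥ p_k of P (any ordering of the paths by nonincreasing length),
-- (1/i) Σ_{j ≤ i} p_j − p_{i+1} ≤ Cmax(P*) for all i ∈ [k-1].
-- Here i = suc i' and p_{i+1} is the entry with 0-based index suc i'.
Balanced : ∀ {G k} → Vec (Path G) k → Vec (Path G) k → Set
Balanced {G} {k} P P* =
  (σ : Permutation′ k) →
  let p = λ (j : Fin k) → len (lookup P (σ ⟨$⟩ʳ j)) in
  Nonincreasing p →
  (i' : ℕ) (h : suc i' ℕ.< k) →
  ((+ sumTo p (suc i')) ℚ./ suc i') ℚ.- ((+ p (fromℕ< h)) ℚ./ 1)
    ℚ.≤ ((+ Cmax P*) ℚ./ 1)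

H : ℕ → ℚ
H zero    = 0ℚ
H (suc n) = H n ℚ.+ ((+ 1) ℚ./ suc n)

{-# OPTIONS --safe #-}

-- Sort the path lengths of P as p₁ ≥ … ≥ p_k, write C = Cmax P* and A_i = (p₁ + … + p_i)/i.
-- Balancedness says p_{i+1} ≥ A_i − C, so A_{i+1} = (i·A_i + p_{i+1})/(i+1) ≥ A_i − C/(i+1).
-- Telescoping from A₁ = p₁ = Cmax P to A_k = θ(P)/k ≤ θ(P*)/k ≤ C (consistency) gives
-- p₁ ≤ C + C·(1/2 + … + 1/k) = H_k·C.  The argument is run in ℕ after multiplying by
-- factorials, with harmonicNumerator n = n!·H_n.

module Submission where

open import Data.Nat as ℕ using (ℕ; zero; suc; _+_; _*_; _!; z≤n; s≤s; NonZero)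
open import Data.Nat.Properties as ℕP using (_!≢0)
open import Data.Nat.Tactic.RingSolver using (solve-∀)
open import Data.Fin using (Fin; zero; suc; fromℕ<)
open import Data.Fin.Permutation as Perm
  using (Permutation′; _⟨$⟩ʳ_; _⟨$⟩ˡ_; _∘ₚ_; lift₀; transpose)
open import Data.Vec using (Vec; []; _∷_; lookup)
open import Data.Product using (Σ; ∃; _,_; proj₁; proj₂)
open import Data.Integer as ℤ using ()
import Data.Integer.Properties as ℤP
open import Data.Rational as ℚ using (toℚᵘ)
import Data.Rational.Properties as ℚP
import Data.Rational.Unnormalised as ℚᵘ
import Data.Rational.Unnormalised.Properties as ℚᵘP
open import Relation.Nullary using (yes; no)
open import Relation.Binary.PropositionalEquality
open import Algebra.Properties.CommutativeMonoid.Sum ℕP.+-0-commutativeMonoid using (sum; ∑-permute)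
open import Algebra.Properties.Group ℚP.+-0-group using (//-rightDividesˡ)
open import Defs

max-index : ∀ {n} (f : Fin (suc n) → ℕ) → ∃ λ m → ∀ j → f j ℕ.≤ f m
max-index {zero} f = zero , λ { zero → ℕP.≤-refl }
max-index {suc n} f with max-index (λ j → f (suc j))
... | m , f≤fm with f zero ℕ.≤? f (suc m)
...   | yes f0≤fm = suc m , λ { zero → f0≤fm ; (suc j) → f≤fm j }
...   | no f0≰fm  = zero , λ { zero → ℕP.≤-refl ; (suc j) → ℕP.≤-trans (f≤fm j) (ℕP.<⇒≤ (ℕP.≰⇒> f0≰fm)) }

sortingPermutation : ∀ {n} (f : Fin n → ℕ) → Σ (Permutation′ n) λ σ → Nonincreasing (λ j → f (σ ⟨$⟩ʳ j))
sortingPermutation {zero} f = Perm.id , λ ()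
sortingPermutation {suc n} f with max-index f
... | m , f≤fm with sortingPermutation (λ j → f (transpose zero m ⟨$⟩ʳ suc j))
...   | σ , sorted = lift₀ σ ∘ₚ transpose zero m , nonincreasing
  where
  nonincreasing : Nonincreasing (λ j → f ((lift₀ σ ∘ₚ transpose zero m) ⟨$⟩ʳ j))
  nonincreasing zero    l       _       = f≤fm _
  nonincreasing (suc j) (suc l) (s≤s q) = sorted j l q

sumTo-zero : ∀ {k} (p : Fin k → ℕ) → sumTo p 0 ≡ 0
sumTo-zero {zero}  p = refl
sumTo-zero {suc k} p = refl

sumTo-suc : ∀ {k} (p : Fin k → ℕ) {m} (m<k : m ℕ.< k) → sumTo p (suc m) ≡ sumTo p m + p (fromℕ< m<k)
sumTo-suc {suc k} p {zero} _ = begin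
  p zero + sumTo (λ j → p (suc j)) 0 ≡⟨ cong (p zero +_) (sumTo-zero (λ j → p (suc j))) ⟩
  p zero + 0                         ≡⟨ ℕP.+-comm (p zero) 0 ⟩
  p zero                             ∎
  where open ≡-Reasoning
sumTo-suc {suc k} p {suc m} (s≤s m<k) = begin
  p zero + sumTo (λ j → p (suc j)) (suc m)                         ≡⟨ cong (p zero +_) (sumTo-suc (λ j → p (suc j)) m<k) ⟩
  p zero + (sumTo (λ j → p (suc j)) m + p (suc (fromℕ< m<k)))      ≡⟨ ℕP.+-assoc (p zero) _ _ ⟨
  p zero + sumTo (λ j → p (suc j)) m + p (suc (fromℕ< m<k))        ∎
  where open ≡-Reasoning

sumTo-one : ∀ {k} (p : Fin (suc k) → ℕ) → sumTo p 1 ≡ p zero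
sumTo-one p = sumTo-suc p (s≤s z≤n)

sumTo-all : ∀ {k} (p : Fin k → ℕ) → sumTo p k ≡ sum p
sumTo-all {zero}  p = refl
sumTo-all {suc k} p = cong (p zero +_) (sumTo-all (λ j → p (suc j)))

lengths : ∀ {G k} → Vec (Path G) k → Fin k → ℕ
lengths P i = len (lookup P i)

θ≡sum-lengths : ∀ {G k} (P : Vec (Path G) k) → θ P ≡ sum (lengths P)
θ≡sum-lengths []      = refl
θ≡sum-lengths (p ∷ P) = cong (len p +_) (θ≡sum-lengths P)

θ≤k*Cmax : ∀ {G k} (P : Vec (Path G) k) → θ P ℕ.≤ k * Cmax P
θ≤k*Cmax []              = z≤n
θ≤k*Cmax {k = suc k} (p ∷ P) = ℕP.+-mono-≤ (ℕP.m≤m⊔n (len p) (Cmax P))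
  (ℕP.≤-trans (θ≤k*Cmax P) (ℕP.*-monoʳ-≤ k (ℕP.m≤n⊔m (len p) (Cmax P))))

Cmax-lub : ∀ {G k} (P : Vec (Path G) k) {B} → (∀ i → lengths P i ℕ.≤ B) → Cmax P ℕ.≤ B
Cmax-lub []      _      = z≤n
Cmax-lub (p ∷ P) len≤B = ℕP.⊔-lub (len≤B zero) (Cmax-lub P (λ i → len≤B (suc i)))

harmonicNumerator : ℕ → ℕ
harmonicNumerator zero    = 0
harmonicNumerator (suc n) = suc n * harmonicNumerator n + n !

module _ {m} (p : Fin (suc m) → ℕ) (C : ℕ)
  (balanced : ∀ i (i<m : suc i ℕ.< suc m) → sumTo p (suc i) ℕ.≤ suc i * (C + p (fromℕ< i<m)))
  where

  -- Divided by (i+1)!, this is  p₀ ≤ A_{i+1} + (H_{i+1} − 1)·C  for the running average A.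
  telescope : ∀ i → i ℕ.≤ m →
              suc i ! * p zero + suc i ! * C ℕ.≤ harmonicNumerator (suc i) * C + i ! * sumTo p (suc i)
  telescope zero    _   rewrite sumTo-one p = ℕP.≤-reflexive (ℕP.+-comm (1 * p zero) (1 * C))
  telescope (suc i) i<m = begin
    suc (suc i) ! * p zero + suc (suc i) ! * C          ≡⟨ distrib (2 + i) (suc i !) (p zero) C ⟨
    (2 + i) * (suc i ! * p zero + suc i ! * C)          ≤⟨ ℕP.*-monoʳ-≤ (2 + i) (telescope i (ℕP.<⇒≤ i<m)) ⟩
    (2 + i) * (h * C + i ! * S)                         ≡⟨ expand i (i !) h C S ⟩
    (2 + i) * h * C + suc i ! * S + i ! * S             ≤⟨ ℕP.+-monoʳ-≤ _ (ℕP.*-monoʳ-≤ (i !) (balanced i (s≤s i<m))) ⟩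
    (2 + i) * h * C + suc i ! * S + i ! * ((1 + i) * (C + q)) ≡⟨ collect i (i !) h C S q ⟩
    harmonicNumerator (2 + i) * C + suc i ! * (S + q)   ≡⟨ cong (λ x → harmonicNumerator (2 + i) * C + suc i ! * x) (sumTo-suc p (s≤s i<m)) ⟨
    harmonicNumerator (2 + i) * C + suc i ! * sumTo p (2 + i) ∎
    where
    open ℕP.≤-Reasoning
    h = harmonicNumerator (suc i)
    S = sumTo p (suc i)
    q = p (fromℕ< (s≤s i<m))
    distrib : ∀ n f a c → n * (f * a + f * c) ≡ n * f * a + n * f * c
    distrib = solve-∀
    expand : ∀ i f h C S → (2 + i) * (h * C + f * S) ≡ (2 + i) * h * C + ((1 + i) * f) * S + f * S
    expand = solve-∀
    collect : ∀ i f h C S q → (2 + i) * h * C + ((1 + i) * f) * S + f * ((1 + i) * (C + q))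
                              ≡ ((2 + i) * h + (1 + i) * f) * C + ((1 + i) * f) * (S + q)
    collect = solve-∀

  head≤harmonic : sumTo p (suc m) ℕ.≤ suc m * C → suc m ! * p zero ℕ.≤ harmonicNumerator (suc m) * C
  head≤harmonic total = ℕP.+-cancelʳ-≤ (suc m ! * C) _ _ (begin
    suc m ! * p zero + suc m ! * C                        ≤⟨ telescope m ℕP.≤-refl ⟩
    harmonicNumerator (suc m) * C + m ! * sumTo p (suc m) ≤⟨ ℕP.+-monoʳ-≤ _ (ℕP.*-monoʳ-≤ (m !) total) ⟩
    harmonicNumerator (suc m) * C + m ! * (suc m * C)     ≡⟨ cong (harmonicNumerator (suc m) * C +_) (reassociate m (m !) C) ⟩
    harmonicNumerator (suc m) * C + suc m ! * C           ∎)
    where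
    open ℕP.≤-Reasoning
    reassociate : ∀ m f C → f * (suc m * C) ≡ suc m * f * C
    reassociate = solve-∀

-- Numerators and denominators are passed explicitly throughout: ℚ._/_ normalises by a gcd
-- computation, so unifying against it is hopeless (and instance search cannot invert _!).
toℚᵘ-/ : ∀ a d .{{_ : NonZero d}} → toℚᵘ (ℤ.+ a ℚ./ d) ℚᵘ.≃ ℤ.+ a ℚᵘ./ d
toℚᵘ-/ a (suc d) = ℚP.toℚᵘ-fromℚᵘ (ℚᵘ.mkℚᵘ (ℤ.+ a) d)

/-≤⇒*-≤ : ∀ a b c d .{{_ : NonZero b}} .{{_ : NonZero d}} →
          ℤ.+ a ℚ./ b ℚ.≤ ℤ.+ c ℚ./ d → a * d ℕ.≤ c * b
/-≤⇒*-≤ a b@(suc _) c d@(suc _) x≤y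
  with ℚᵘP.≤-respʳ-≃ (toℚᵘ-/ c d) (ℚᵘP.≤-respˡ-≃ (toℚᵘ-/ a b) (ℚP.toℚᵘ-mono-≤ x≤y))
... | ℚᵘ.*≤* ad≤cb = ℤP.drop‿+≤+ (subst₂ ℤ._≤_ (sym (ℤP.pos-* a d)) (sym (ℤP.pos-* c b)) ad≤cb)

*-≤⇒/-≤ : ∀ a b c d .{{_ : NonZero b}} .{{_ : NonZero d}} →
          a * d ℕ.≤ c * b → ℤ.+ a ℚ./ b ℚ.≤ ℤ.+ c ℚ./ d
*-≤⇒/-≤ a b@(suc _) c d@(suc _) ad≤cb =
  ℚP.toℚᵘ-cancel-≤ (ℚᵘP.≤-respˡ-≃ (ℚᵘP.≃-sym (toℚᵘ-/ a b)) (ℚᵘP.≤-respʳ-≃ (ℚᵘP.≃-sym (toℚᵘ-/ c d))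
    (ℚᵘ.*≤* (subst₂ ℤ._≤_ (ℤP.pos-* a d) (ℤP.pos-* c b) (ℤ.+≤+ ad≤cb)))))

/-+-/ : ∀ a b c d .{{_ : NonZero b}} .{{_ : NonZero d}} →
        ℤ.+ a ℚ./ b ℚ.+ ℤ.+ c ℚ./ d ≡ (ℤ.+ (a * d + c * b) ℚ./ (b * d)) {{ℕP.m*n≢0 b d}}
/-+-/ a b@(suc _) c d@(suc _) = ℚP.toℚᵘ-injective (begin
  toℚᵘ (ℤ.+ a ℚ./ b ℚ.+ ℤ.+ c ℚ./ d)                     ≈⟨ ℚP.toℚᵘ-homo-+ (ℤ.+ a ℚ./ b) (ℤ.+ c ℚ./ d) ⟩
  toℚᵘ (ℤ.+ a ℚ./ b) ℚᵘ.+ toℚᵘ (ℤ.+ c ℚ./ d)             ≈⟨ ℚᵘP.+-cong (toℚᵘ-/ a b) (toℚᵘ-/ c d) ⟩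
  (ℤ.+ a ℤ.* ℤ.+ d ℤ.+ ℤ.+ c ℤ.* ℤ.+ b) ℚᵘ./ (b * d)    ≡⟨ cong (ℚᵘ._/ (b * d)) numerator ⟩
  ℤ.+ (a * d + c * b) ℚᵘ./ (b * d)                       ≈⟨ toℚᵘ-/ (a * d + c * b) (b * d) ⟨
  toℚᵘ ((ℤ.+ (a * d + c * b) ℚ./ (b * d)) {{ℕP.m*n≢0 b d}}) ∎)
  where
  open ℚᵘP.≃-Reasoning
  numerator : ℤ.+ a ℤ.* ℤ.+ d ℤ.+ ℤ.+ c ℤ.* ℤ.+ b ≡ ℤ.+ (a * d + c * b)
  numerator = trans (sym (cong₂ ℤ._+_ (ℤP.pos-* a d) (ℤP.pos-* c b))) (sym (ℤP.pos-+ (a * d) (c * b)))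

/-*-/ : ∀ a b c d .{{_ : NonZero b}} .{{_ : NonZero d}} →
        (ℤ.+ a ℚ./ b) ℚ.* (ℤ.+ c ℚ./ d) ≡ (ℤ.+ (a * c) ℚ./ (b * d)) {{ℕP.m*n≢0 b d}}
/-*-/ a b@(suc _) c d@(suc _) = ℚP.toℚᵘ-injective (begin
  toℚᵘ ((ℤ.+ a ℚ./ b) ℚ.* (ℤ.+ c ℚ./ d))              ≈⟨ ℚP.toℚᵘ-homo-* (ℤ.+ a ℚ./ b) (ℤ.+ c ℚ./ d) ⟩
  toℚᵘ (ℤ.+ a ℚ./ b) ℚᵘ.* toℚᵘ (ℤ.+ c ℚ./ d)      ≈⟨ ℚᵘP.*-cong (toℚᵘ-/ a b) (toℚᵘ-/ c d) ⟩
  (ℤ.+ a ℤ.* ℤ.+ c) ℚᵘ./ (b * d)                  ≡⟨ cong (ℚᵘ._/ (b * d)) (ℤP.pos-* a c) ⟨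
  ℤ.+ (a * c) ℚᵘ./ (b * d)                        ≈⟨ toℚᵘ-/ (a * c) (b * d) ⟨
  toℚᵘ ((ℤ.+ (a * c) ℚ./ (b * d)) {{ℕP.m*n≢0 b d}}) ∎)
  where open ℚᵘP.≃-Reasoning

H≡harmonicNumerator/! : ∀ n → H n ≡ (ℤ.+ harmonicNumerator n ℚ./ n !) {{n !≢0}}
H≡harmonicNumerator/! zero    = refl
H≡harmonicNumerator/! (suc n) = begin
  H n ℚ.+ ℤ.+ 1 ℚ./ suc n                                        ≡⟨ cong (ℚ._+ (ℤ.+ 1 ℚ./ suc n)) (H≡harmonicNumerator/! n) ⟩
  ℤ.+ harmonicNumerator n ℚ./ n ! ℚ.+ ℤ.+ 1 ℚ./ suc n            ≡⟨ /-+-/ (harmonicNumerator n) (n !) 1 (suc n) ⟩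
  ℤ.+ (harmonicNumerator n * suc n + 1 * n !) ℚ./ (n ! * suc n)  ≡⟨ ℚP./-cong (cong ℤ.+_ numerator) (ℕP.*-comm (n !) (suc n)) ⟩
  ℤ.+ harmonicNumerator (suc n) ℚ./ suc n !                      ∎
  where
  open ≡-Reasoning
  instance
    _ = n !≢0
    _ = suc n !≢0
    _ = ℕP.m*n≢0 (n !) (suc n)
  numerator : harmonicNumerator n * suc n + 1 * n ! ≡ harmonicNumerator (suc n)
  numerator = rearrange n (harmonicNumerator n) (n !)
    where
    rearrange : ∀ n h f → h * suc n + 1 * f ≡ suc n * h + f
    rearrange = solve-∀

harmonic-bound : ∀ k {M C} → k ! * M ℕ.≤ harmonicNumerator k * C →
                 ℤ.+ M ℚ./ 1 ℚ.≤ H k ℚ.* (ℤ.+ C ℚ./ 1)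
harmonic-bound k {M} {C} k!M≤hC = begin
  ℤ.+ M ℚ./ 1                                          ≤⟨ *-≤⇒/-≤ M 1 (harmonicNumerator k * C) (k ! * 1) cross ⟩
  ℤ.+ (harmonicNumerator k * C) ℚ./ (k ! * 1)          ≡⟨ /-*-/ (harmonicNumerator k) (k !) C 1 ⟨
  (ℤ.+ harmonicNumerator k ℚ./ k !) ℚ.* (ℤ.+ C ℚ./ 1)  ≡⟨ cong (ℚ._* (ℤ.+ C ℚ./ 1)) (H≡harmonicNumerator/! k) ⟨
  H k ℚ.* (ℤ.+ C ℚ./ 1)                                ∎
  where
  open ℚP.≤-Reasoning
  instance
    _ = k !≢0
    _ = ℕP.m*n≢0 (k !) 1
  cross : M * (k ! * 1) ℕ.≤ harmonicNumerator k * C * 1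
  cross = subst₂ ℕ._≤_ (swap M (k !)) (sym (ℕP.*-identityʳ _)) k!M≤hC
    where
    swap : ∀ m f → f * m ≡ m * (f * 1)
    swap = solve-∀

balanced⇒≤ : ∀ S n q C .{{_ : NonZero n}} →
             ℤ.+ S ℚ./ n ℚ.- ℤ.+ q ℚ./ 1 ℚ.≤ ℤ.+ C ℚ./ 1 → S ℕ.≤ n * (C + q)
balanced⇒≤ S n q C avg-q≤C =
  subst₂ ℕ._≤_ (ℕP.*-identityʳ S) (rearrange C q n) (/-≤⇒*-≤ S n (C * 1 + q * 1) (1 * 1) avg≤C+q)
  where
  open ℚP.≤-Reasoning
  avg≤C+q : ℤ.+ S ℚ./ n ℚ.≤ ℤ.+ (C * 1 + q * 1) ℚ./ (1 * 1)
  avg≤C+q = begin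
    ℤ.+ S ℚ./ n                                      ≡⟨ //-rightDividesˡ (ℤ.+ q ℚ./ 1) (ℤ.+ S ℚ./ n) ⟨
    ℤ.+ S ℚ./ n ℚ.- ℤ.+ q ℚ./ 1 ℚ.+ ℤ.+ q ℚ./ 1      ≤⟨ ℚP.+-monoˡ-≤ (ℤ.+ q ℚ./ 1) avg-q≤C ⟩
    ℤ.+ C ℚ./ 1 ℚ.+ ℤ.+ q ℚ./ 1                      ≡⟨ /-+-/ C 1 q 1 ⟩
    ℤ.+ (C * 1 + q * 1) ℚ./ (1 * 1)                  ∎
  rearrange : ∀ C q n → (C * 1 + q * 1) * n ≡ n * (C + q)
  rearrange = solve-∀

Cmax≤harmonic : ∀ {G k} (P* P : Vec (Path G) k) → Consistent P P* → Balanced P P* →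
                k ! * Cmax P ℕ.≤ harmonicNumerator k * Cmax P*
Cmax≤harmonic [] [] _ _ = z≤n
Cmax≤harmonic {k = suc m} P* P consistent balanced = begin
  suc m ! * Cmax P              ≤⟨ ℕP.*-monoʳ-≤ (suc m !) Cmax≤p₀ ⟩
  suc m ! * p zero              ≤⟨ head≤harmonic p C balanced-ℕ total ⟩
  harmonicNumerator (suc m) * C ∎
  where
  open ℕP.≤-Reasoning
  C = Cmax P*
  σ : Permutation′ (suc m)
  σ = proj₁ (sortingPermutation (lengths P))
  p : Fin (suc m) → ℕ
  p j = lengths P (σ ⟨$⟩ʳ j)
  sorted : Nonincreasing p
  sorted = proj₂ (sortingPermutation (lengths P))
  Cmax≤p₀ : Cmax P ℕ.≤ p zero
  Cmax≤p₀ = Cmax-lub P λ i →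
    subst (ℕ._≤ p zero) (cong (lengths P) (Perm.inverseʳ σ)) (sorted zero (σ ⟨$⟩ˡ i) z≤n)
  balanced-ℕ : ∀ i (i<m : suc i ℕ.< suc m) → sumTo p (suc i) ℕ.≤ suc i * (C + p (fromℕ< i<m))
  balanced-ℕ i i<m = balanced⇒≤ (sumTo p (suc i)) (suc i) (p (fromℕ< i<m)) C (balanced σ sorted i i<m)
  total : sumTo p (suc m) ℕ.≤ suc m * C
  total = begin
    sumTo p (suc m)     ≡⟨ sumTo-all p ⟩
    sum p               ≡⟨ ∑-permute (lengths P) σ ⟨
    sum (lengths P)     ≡⟨ θ≡sum-lengths P ⟨
    θ P                 ≤⟨ consistent ⟩
    θ P*                ≤⟨ θ≤k*Cmax P* ⟩
    suc m * C           ∎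

lemma10 : (D : SP) (k : ℕ) (P* P : Vec (Path D) k) →
          IsOptimal P* → IsProfile P → Consistent P P* → Balanced P P* →
          ((ℤ.+ Cmax P) ℚ./ 1) ℚ.≤ (H k ℚ.* ((ℤ.+ Cmax P*) ℚ./ 1))
lemma10 _ k P* P _ _ consistent balanced = harmonic-bound k (Cmax≤harmonic P* P consistent balanced)
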